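{- Let $p,q,k\ge1$, let $G_{\mathrm{dup}}$ be a $(p,q,k)$-DUP graph on $n_1$ vertices with layers $U_1,\dots,U_{k+1}$ and UPCs $\mathcal{P}_1,\dots,\mathcal{P}_q$, where $\mathcal{P}_i=\{P_{i,1},\dots,P_{i,p}\}$. Let $\mathcal{H}=\{H_{i,j} : i\in[q], j\in[p]\}$ be a family of $(n_2,k+1)$-layered graphs all on the same layers $W_1,\dots,W_{k+1}$, and let $G=\mathrm{embed}(\mathcal{H}\to G_{\mathrm{dup}})$. Then for every $i\in[q]$, the induced subgraph of $G$ on the vertex set $\{(v,w) \in V(G) : v \text{ lies on some path } P_{i,j}\in\mathcal{P}_i\}$ is the vertex-disjoint union, over $j\in[p]$, of the copies of $H_{i,j}$ placed along $P_{i,j}$; that is, writing $P_{i,j}=(u_1,\dots,u_{k+1})$, the sets $\bigcup_{\ell}\{u_\ell\}\times W_\ell$ are pairwise disjoint over $j$, the map $(u_\ell,w)\mapsto w$ is an isomorphism from the subgraph of $G$ induced on $\bigcup_\ell \{u_\ell\}\times W_\ell$ onto $H_{i,j}$, and there are no edges of $G$ between the vertex sets corresponding to distinct paths $P_{i,j}, P_{i,j'}$.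
   Context: For $n,k\ge1$, an $(n,k)$-layered graph is a graph together with an equipartition of its vertex set into $k$ independent sets (layers) of size $n/k$ each; edges may join any two distinct layers. It is strictly layered if all edges join consecutive layers. In a strictly-layered graph, a layered path has exactly one vertex in each layer and edges only between consecutive layers; $\mathrm{start}(P)$ and $\mathrm{final}(P)$ denote its vertices in the first and last layer. A set $\mathcal{P}$ of paths in a strictly-layered graph $G$ is a unique path collection (UPC) if (i) its paths are pairwise vertex-disjoint layered paths, and (ii) for every $s\in\{\mathrm{start}(P):P\in\mathcal{P}\}$ and $t\in\{\mathrm{final}(P):P\in\mathcal{P}\}$, every layered path in $G$ from $s$ to $t$ belongs to $\mathcal{P}$. A $(p,q,k)$-DUP graph is an $(n,k+1)$-strictly-layered graph whose edge set is partitioned into $q$ UPCs $\mathcal{P}_1,\dots,\mathcal{P}_q$, each consisting of exactly $p$ layered paths $P_{i,1},\dots,P_{i,p}$. Embedding product: given $G_{\mathrm{dup}}$ and $\mathcal{H}$ as in the claim, $\mathrm{embed}(\mathcal{H}\to G_{\mathrm{dup}})$ is the $((n_1 n_2)/(k+1),k+1)$-layered graph with layers $V_\ell = U_\ell\times W_\ell$ for $\ell\in[k+1]$, whose edges are as follows: for every $i\in[q]$, $j\in[p]$, writing $P_{i,j}=(u_1,\dots,u_{k+1})$ with $u_\ell\in U_\ell$, and for every edge $(x,y)$ of $H_{i,j}$ with $x\in W_{\ell_x}$, $y\in W_{\ell_y}$, add the edge between $(u_{\ell_x},x)$ and $(u_{\ell_y},y)$; there are no other edges. -}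

module Defs where

open import Data.Nat using (ℕ; suc)
open import Data.Fin using (Fin; zero; suc; inject₁; fromℕ; toℕ)
open import Data.Product using (Σ; ∃; ∃-syntax; _×_; _,_)
open import Data.Sum using (_⊎_)
open import Relation.Nullary using (¬_)
open import Relation.Binary.PropositionalEquality using (_≡_; _≢_)

-- A (K*m, K)-layered graph: K layers (independent sets), each of size m.
Vertex : ℕ → ℕ → Set
Vertex K m = Fin K × Fin m

record LayeredGraph (K m : ℕ) : Set₁ where
  field
    Adj   : Vertex K m → Vertex K m → Set
    sym   : ∀ {x y} → Adj x y → Adj y x
    indep : ∀ {ℓ a b} → ¬ Adj (ℓ , a) (ℓ , b)
open LayeredGraph public

IsStrictlyLayered : ∀ {K m} → LayeredGraph K m → Set
IsStrictlyLayered G = ∀ ℓ a ℓ' b → Adj G (ℓ , a) (ℓ' , b) →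
  (toℕ ℓ' ≡ suc (toℕ ℓ)) ⊎ (toℕ ℓ ≡ suc (toℕ ℓ'))

Path : ℕ → ℕ → Set
Path k m = Fin (suc k) → Fin m

start : ∀ {k m} → Path k m → Fin m
start P = P zero

final : ∀ {k m} → Path k m → Fin m
final {k} P = P (fromℕ k)

IsLayeredPath : ∀ {k m} → LayeredGraph (suc k) m → Path k m → Set
IsLayeredPath {k} G P =
  (ℓ : Fin k) → Adj G (inject₁ ℓ , P (inject₁ ℓ)) (suc ℓ , P (suc ℓ))

EdgeOn : ∀ {k m} → Path k m → Vertex (suc k) m → Vertex (suc k) m → Set
EdgeOn {k} P x y = ∃[ ℓ ] (
    (x ≡ (inject₁ ℓ , P (inject₁ ℓ)) × y ≡ (suc ℓ , P (suc ℓ)))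
  ⊎ (y ≡ (inject₁ ℓ , P (inject₁ ℓ)) × x ≡ (suc ℓ , P (suc ℓ))))

_∈Paths_ : ∀ {k m p} → Path k m → (Fin p → Path k m) → Set
Q ∈Paths Ps = ∃[ j ] (∀ ℓ → Q ℓ ≡ Ps j ℓ)

record IsUPC {k m p} (G : LayeredGraph (suc k) m) (Ps : Fin p → Path k m) : Set where
  field
    layered  : ∀ j → IsLayeredPath G (Ps j)
    disjoint : ∀ j j' → j ≢ j' → ∀ ℓ → Ps j ℓ ≢ Ps j' ℓ
    unique   : ∀ j j' (Q : Path k m) → IsLayeredPath G Q →
               start Q ≡ start (Ps j) → final Q ≡ final (Ps j') → Q ∈Paths Ps

-- (p,q,k)-DUP graph with layers of size m (so n = (k+1)*m vertices).
record DUP (p q k m : ℕ) : Set₁ where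
  field
    graph    : LayeredGraph (suc k) m
    strict   : IsStrictlyLayered graph
    paths    : Fin q → Fin p → Path k m
    upc      : ∀ i → IsUPC graph (paths i)
    covered  : ∀ x y → Adj graph x y → ∃[ i ] ∃[ j ] EdgeOn (paths i j) x y
    partition : ∀ x y i j i' j' → EdgeOn (paths i j) x y → EdgeOn (paths i' j') x y → i ≡ i'
open DUP public

-- Vertices of embed(H → G_dup): layer ℓ is U_ℓ × W_ℓ, so a vertex is (ℓ , (u , w)).
EmbVertex : ℕ → ℕ → ℕ → Set
EmbVertex k m₁ m₂ = Fin (suc k) × (Fin m₁ × Fin m₂)

EmbedAdj : ∀ {p q k m₁ m₂} → DUP p q k m₁ → (Fin q → Fin p → LayeredGraph (suc k) m₂) →
           EmbVertex k m₁ m₂ → EmbVertex k m₁ m₂ → Set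
EmbedAdj {p} {q} D H (ℓx , (a , x)) (ℓy , (b , y)) =
  Σ (Fin q) λ i → Σ (Fin p) λ j →
    Adj (H i j) (ℓx , x) (ℓy , y) × a ≡ paths D i j ℓx × b ≡ paths D i j ℓy

{-# OPTIONS --safe #-}
module Submission where

open import Defs
open import Data.Nat using (ℕ; suc; _≤_)
open import Data.Nat using (z≤n)
open import Data.Fin using (Fin)
open import Data.Product using (_×_; _,_)
open import Data.Product using (proj₁; proj₂)
open import Data.Product.Properties using (,-injective)
open import Relation.Nullary using (¬_)
open import Relation.Binary.PropositionalEquality using (_≢_)
open import Function.Bundles using (_⇔_)

import Data.Nat.Properties as ℕ
open import Data.Fin as Fin using (zero; suc; inject₁; fromℕ; _≟_)
open import Data.Fin.Properties using (_≤?_; _<?_; ≤-antisym; ≤-refl; <-cmp; ≤fromℕ; <⇒≤pred; ≤̄⇒inject₁<; ℕ<⇒inject₁<)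
open import Data.Empty using (⊥-elim)
open import Data.Sum using (inj₁)
open import Relation.Binary.Definitions using (tri<; tri≈; tri>)
open import Relation.Binary.PropositionalEquality as ≡ using (_≡_; refl; cong; trans; subst₂)
open import Relation.Nullary using (yes; no; contradiction)
open import Relation.Nullary.Decidable using (decidable-stable)
open import Function.Bundles using (mk⇔)

-- If an edge of the embedding joins the copies of P i j and P i j' at layers ℓ < ℓ', it comes
-- from some H i' j'', so P i' j'' meets P i j at ℓ and P i j' at ℓ'.  Following P i j up to ℓ,
-- then P i' j'', then P i j' from ℓ' on, gives a layered path between endpoints of the UPC i,
-- which must therefore be one of its paths: so j = j', and P i' j'' runs along P i j from ℓ to ℓ'.
-- The two paths then share an edge, and as the UPCs partition the edges, (i' , j'') = (i , j).

module _ {k m : ℕ} where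

  glue : Fin (suc k) → Path k m → Path k m → Path k m
  glue ℓ A B t with t ≤? ℓ
  ... | yes _ = A t
  ... | no  _ = B t

  glue-≤ : ∀ {ℓ t} (A B : Path k m) → t Fin.≤ ℓ → glue ℓ A B t ≡ A t
  glue-≤ {ℓ} {t} A B t≤ℓ with t ≤? ℓ
  ... | yes _   = refl
  ... | no  t≰ℓ = contradiction t≤ℓ t≰ℓ

  glue-≥ : ∀ {ℓ t} (A B : Path k m) → A ℓ ≡ B ℓ → ℓ Fin.≤ t → glue ℓ A B t ≡ B t
  glue-≥ {ℓ} {t} A B Aℓ≡Bℓ ℓ≤t with t ≤? ℓ
  ... | yes t≤ℓ rewrite ≤-antisym t≤ℓ ℓ≤t = Aℓ≡Bℓ
  ... | no  _   = refl

  module _ {G : LayeredGraph (suc k) m} where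

    edge-cong : ∀ {A B : Path k m} s → A (inject₁ s) ≡ B (inject₁ s) → A (suc s) ≡ B (suc s) →
                Adj G (inject₁ s , A (inject₁ s)) (suc s , A (suc s)) →
                Adj G (inject₁ s , B (inject₁ s)) (suc s , B (suc s))
    edge-cong s = subst₂ (λ a b → Adj G (inject₁ s , a) (suc s , b))

    glue-layered : ∀ {ℓ} {A B : Path k m} → IsLayeredPath G A → IsLayeredPath G B →
                   A ℓ ≡ B ℓ → IsLayeredPath G (glue ℓ A B)
    glue-layered {ℓ} {A} {B} LA LB Aℓ≡Bℓ s with ℓ <? suc s
    ... | yes ℓ<s+1 = edge-cong {B} {glue ℓ A B} s
          (≡.sym (glue-≥ A B Aℓ≡Bℓ (<⇒≤pred ℓ<s+1)))
          (≡.sym (glue-≥ A B Aℓ≡Bℓ (ℕ.<⇒≤ ℓ<s+1))) (LB s)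
    ... | no  ℓ≮s+1 = edge-cong {A} {glue ℓ A B} s
          (≡.sym (glue-≤ A B (ℕ.<⇒≤ (ℕ<⇒inject₁< s+1≤ℓ))))
          (≡.sym (glue-≤ A B s+1≤ℓ)) (LA s)
      where
        s+1≤ℓ : suc s Fin.≤ ℓ
        s+1≤ℓ = ℕ.≮⇒≥ ℓ≮s+1

module _ {k m p} {G : LayeredGraph (suc k) m} {Ps : Fin p → Path k m} (U : IsUPC G Ps) where
  open IsUPC U

  upc-index-unique : ∀ {j j'} ℓ → Ps j ℓ ≡ Ps j' ℓ → j ≡ j'
  upc-index-unique {j} {j'} ℓ e = decidable-stable (j ≟ j') (λ j≢j' → disjoint j j' j≢j' ℓ e)

  upc-detour : ∀ {j j' ℓ ℓ'} {B : Path k m} → IsLayeredPath G B → ℓ Fin.≤ ℓ' →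
               Ps j ℓ ≡ B ℓ → B ℓ' ≡ Ps j' ℓ' →
               j ≡ j' × (∀ {t} → ℓ Fin.≤ t → t Fin.≤ ℓ' → B t ≡ Ps j t)
  upc-detour {j} {j'} {ℓ} {ℓ'} {B} LB ℓ≤ℓ' entry exit =
    along-member (unique j j' Q Q-layered Q-start Q-final)
    where
      Q : Path k m
      Q = glue ℓ (Ps j) (glue ℓ' B (Ps j'))

      junction : Ps j ℓ ≡ glue ℓ' B (Ps j') ℓ
      junction = trans entry (≡.sym (glue-≤ B (Ps j') ℓ≤ℓ'))

      Q-layered : IsLayeredPath G Q
      Q-layered = glue-layered {G = G} (layered j) (glue-layered {G = G} LB (layered j') exit) junction

      Q-start : Q zero ≡ Ps j zero
      Q-start = glue-≤ {ℓ = ℓ} (Ps j) (glue ℓ' B (Ps j')) z≤n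

      Q-final : Q (fromℕ k) ≡ Ps j' (fromℕ k)
      Q-final = trans (glue-≥ (Ps j) (glue ℓ' B (Ps j')) junction (≤fromℕ ℓ)) (glue-≥ B (Ps j') exit (≤fromℕ ℓ'))

      Q-middle : ∀ {t} → ℓ Fin.≤ t → t Fin.≤ ℓ' → Q t ≡ B t
      Q-middle ℓ≤t t≤ℓ' = trans (glue-≥ (Ps j) (glue ℓ' B (Ps j')) junction ℓ≤t) (glue-≤ B (Ps j') t≤ℓ')

      along-member : Q ∈Paths Ps → j ≡ j' × (∀ {t} → ℓ Fin.≤ t → t Fin.≤ ℓ' → B t ≡ Ps j t)
      along-member (j₀ , Q≡Ps) = trans j≡j₀ (≡.sym j'≡j₀) , λ ℓ≤t t≤ℓ' →
          trans (≡.sym (Q-middle ℓ≤t t≤ℓ')) (trans (Q≡Ps _) (cong (λ j → Ps j _) (≡.sym j≡j₀)))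
        where
          j≡j₀ : j ≡ j₀
          j≡j₀ = upc-index-unique zero (trans (≡.sym Q-start) (Q≡Ps zero))
          j'≡j₀ : j' ≡ j₀
          j'≡j₀ = upc-index-unique (fromℕ k) (trans (≡.sym Q-final) (Q≡Ps (fromℕ k)))

module _ {p q k m₁ : ℕ} (D : DUP p q k m₁) where

  dup-paths-meeting-twice : ∀ {i i' j j' j''} {ℓ ℓ' : Fin (suc k)} → ℓ Fin.< ℓ' →
    paths D i j ℓ ≡ paths D i' j'' ℓ → paths D i' j'' ℓ' ≡ paths D i j' ℓ' →
    i ≡ i' × j ≡ j'' × j ≡ j'
  dup-paths-meeting-twice {i} {i'} {j} {j'} {j''} {ℓ} {suc s} ℓ<ℓ' entry exit
    with upc-detour (upc D i) (IsUPC.layered (upc D i') j'') (ℕ.<⇒≤ ℓ<ℓ') entry exit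
  ... | j≡j' , along with dup-edge-shared
    where
      dup-edge-shared : i' ≡ i
      dup-edge-shared = partition D _ _ i' j'' i j (s , inj₁ (refl , refl))
        (s , inj₁ (cong (inject₁ s ,_) (along (<⇒≤pred ℓ<ℓ') (ℕ.<⇒≤ (≤̄⇒inject₁< ≤-refl))) ,
                   cong (suc s ,_) (along (ℕ.<⇒≤ ℓ<ℓ') ℕ.≤-refl)))
  ... | refl = refl , upc-index-unique (upc D i) ℓ entry , j≡j'

  embedAdj-within-upc : ∀ {m₂} (H : Fin q → Fin p → LayeredGraph (suc k) m₂) {i j j' ℓ ℓ' w w'} →
    EmbedAdj D H (ℓ , (paths D i j ℓ , w)) (ℓ' , (paths D i j' ℓ' , w')) →
    j ≡ j' × Adj (H i j) (ℓ , w) (ℓ' , w')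
  embedAdj-within-upc H {ℓ = ℓ} {ℓ'} (i' , j'' , adj , e , e') with <-cmp ℓ ℓ'
  ... | tri< ℓ<ℓ' _ _ with dup-paths-meeting-twice ℓ<ℓ' e (≡.sym e')
  ...   | refl , refl , refl = refl , adj
  embedAdj-within-upc H (i' , j'' , adj , e , e') | tri> _ _ ℓ'<ℓ
    with dup-paths-meeting-twice ℓ'<ℓ e' (≡.sym e)
  ...   | refl , refl , refl = refl , adj
  embedAdj-within-upc H (i' , j'' , adj , e , e') | tri≈ _ refl _ = ⊥-elim (indep (H i' j'') adj)

lemma4p2 : ∀ {p q k m₁ m₂} → 1 ≤ p → 1 ≤ q → 1 ≤ k →
    (D : DUP p q k m₁) (H : Fin q → Fin p → LayeredGraph (suc k) m₂) (i : Fin q) →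
    ((j j' : Fin p) → j ≢ j' → ∀ ℓ ℓ' w w' →
        _≢_ {A = EmbVertex k m₁ m₂} (ℓ , (paths D i j ℓ , w)) (ℓ' , (paths D i j' ℓ' , w')))
    × ((j : Fin p) → ∀ ℓ ℓ' w w' →
        EmbedAdj D H (ℓ , (paths D i j ℓ , w)) (ℓ' , (paths D i j ℓ' , w'))
          ⇔ Adj (H i j) (ℓ , w) (ℓ' , w'))
    × ((j j' : Fin p) → j ≢ j' → ∀ ℓ ℓ' w w' →
        ¬ EmbedAdj D H (ℓ , (paths D i j ℓ , w)) (ℓ' , (paths D i j' ℓ' , w')))
lemma4p2 _ _ _ D H i = copies-disjoint , copy-isomorphic , no-edges-between-copies
  where
    copies-disjoint : ∀ j j' → j ≢ j' → ∀ ℓ ℓ' w w' → (ℓ , (paths D i j ℓ , w)) ≢ (ℓ' , (paths D i j' ℓ' , w'))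
    copies-disjoint j j' j≢j' ℓ ℓ' w w' e with ,-injective e
    ... | refl , e′ = IsUPC.disjoint (upc D i) j j' j≢j' ℓ (proj₁ (,-injective e′))

    copy-isomorphic : ∀ j ℓ ℓ' w w' →
      EmbedAdj D H (ℓ , (paths D i j ℓ , w)) (ℓ' , (paths D i j ℓ' , w')) ⇔ Adj (H i j) (ℓ , w) (ℓ' , w')
    copy-isomorphic j ℓ ℓ' w w' =
      mk⇔ (λ adj → proj₂ (embedAdj-within-upc D H adj)) (λ adj → i , j , adj , refl , refl)

    no-edges-between-copies : ∀ j j' → j ≢ j' → ∀ ℓ ℓ' w w' →
      ¬ EmbedAdj D H (ℓ , (paths D i j ℓ , w)) (ℓ' , (paths D i j' ℓ' , w'))
    no-edges-between-copies j j' j≢j' ℓ ℓ' w w' adj = j≢j' (proj₁ (embedAdj-within-upc D H adj))
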